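{- Let $\mathbf{a}$ be a weakly increasing weak composition of length $n$ and $\mathbf{b}$ any weak composition of length $n$. Then $a_i\le b_i$ for all $i$ if and only if $\mathbf{a}\preceq\mathbf{b}$ in the key poset.
   Context: A weak composition of length $n$ is a sequence $(a_1,\dots,a_n)$ of nonnegative integers. The key poset: $\mathbf{a}\preceq\mathbf{b}$ iff $a_i\le b_i$ for all $i$ and, for all $1\le i<j\le n$ with $b_j>a_j$ and $a_i>a_j$, we have $b_i>b_j$. -}

module Defs where

open import Data.Nat using (ℕ; _≤_; _<_)
open import Data.Product using (_×_)
open import Data.Fin using (Fin) renaming (_<_ to _<ᶠ_; _≤_ to _≤ᶠ_)

-- A weak composition of length n: a sequence (a_1,…,a_n) of nonnegative
-- integers, represented as a function Fin n → ℕ (index i ↦ a_{i+1}).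
WeakComp : ℕ → Set
WeakComp n = Fin n → ℕ

_≤ᶜ_ : ∀ {n} → WeakComp n → WeakComp n → Set
a ≤ᶜ b = ∀ i → a i ≤ b i

WeaklyIncreasing : ∀ {n} → WeakComp n → Set
WeaklyIncreasing a = ∀ i j → i ≤ᶠ j → a i ≤ a j

_≼_ : ∀ {n} → WeakComp n → WeakComp n → Set
a ≼ b = a ≤ᶜ b × (∀ i j → i <ᶠ j → a j < b j → a j < a i → b j < b i)

-- A weakly increasing composition has no descent a_j < a_i with i < j, so the
-- second clause of the key order is vacuous and ≼ reduces to the componentwise order.
module Submission where

open import Defs
open import Data.Nat using (ℕ; _<_)
open import Data.Nat.Properties using (<⇒≱; <⇒≤)
open import Data.Fin using () renaming (_<_ to _<ᶠ_)
open import Data.Product using (_×_; _,_; proj₁)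
open import Data.Empty using (⊥-elim)
open import Relation.Nullary using (¬_)

WeaklyIncreasing⇒¬descent : ∀ {n} {a : WeakComp n} → WeaklyIncreasing a →
                            ∀ {i j} → i <ᶠ j → ¬ a j < a i
WeaklyIncreasing⇒¬descent inc i<j aj<ai = <⇒≱ aj<ai (inc _ _ (<⇒≤ i<j))

≤ᶜ⇒≼ : ∀ {n} {a b : WeakComp n} → WeaklyIncreasing a → a ≤ᶜ b → a ≼ b
≤ᶜ⇒≼ inc a≤b = a≤b , λ _ _ i<j _ aj<ai →
  ⊥-elim (WeaklyIncreasing⇒¬descent inc i<j aj<ai)

proposition2p5 : (n : ℕ) (a b : WeakComp n) → WeaklyIncreasing a →
                   ((a ≤ᶜ b → a ≼ b) × (a ≼ b → a ≤ᶜ b))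
proposition2p5 n a b inc = ≤ᶜ⇒≼ inc , proj₁
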